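{- For every positive integer $d$ there exists $\varepsilon=\varepsilon(d)>0$ such that the following holds. Let $n\ge d\ge k\ge1$ be integers, let $V$ be a binary projective space with $\dim(V)=n$, let $W$ be a subspace of $V$ of codimension $k$, and let $N$ be a pattern with $\dim(N)=d-k$. Let $M$ be a matroid with $V(M)=W$ containing an $N$-instance. Then for every $N'\in\mathrm{Ext}^k(N)$ there are at most $2^{2^n(1-2^{ -k}-\varepsilon)}$ matroids $M'':V\to\{0,1\}$ with $M''|_W=M$ that are $N'$-free.
   Context: A binary projective space is a set $V=V'\setminus\{0\}$ where $V'$ is a finite-dimensional $\mathbb{F}_2$-vector space; $\dim(V)=\dim_{\mathbb{F}_2}(V')$. A subspace is $U'\setminus\{0\}$ with $U'\le V'$ linear; its codimension is $\dim(V)-\dim(U)$. A linear injection between binary projective spaces is the restriction of an injective linear map of the underlying vector spaces. A matroid is a function $M:V(M)\to\{0,1\}$ with $V(M)$ a binary projective space. A pattern is a function $N:V(N)\to\{0,1,\star\}$ with $V(N)$ a binary projective space, $\dim(N)=\dim(V(N))$. For a pattern $N$ and a matroid or pattern $M$, an $N$-instance in $M$ is a linear injection $\phi:V(N)\to V(M)$ with $M(\phi(x))=N(x)$ whenever $N(x)\in\{0,1\}$; $M$ is $N$-free if there is no $N$-instance in $M$. For $k\ge0$, $\mathrm{Ext}^k(N)$ is the set of all $N'$ (patterns) with $\dim(N')\le\dim(N)+k$ such that $N$ is isomorphic to the restriction of $N'$ to a subspace of $V(N')$ of codimension at most $k$ (isomorphism meaning equality after composing with an invertible linear map). -}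

module Defs where

open import Data.Bool using (Bool; true; false; _xor_)
open import Data.Maybe using (Maybe; just; nothing)
open import Data.Nat using (ℕ)
open import Data.Vec using (Vec; replicate; zipWith)
open import Relation.Binary.PropositionalEquality using (_≡_; _≢_)

-- The binary projective space of dimension n is modelled as the nonzero
-- vectors of 𝔽₂ⁿ = Vec Bool n (every binary projective space of dimension n
-- is isomorphic to this one).
𝔽₂^ : ℕ → Set
𝔽₂^ n = Vec Bool n

𝟎 : ∀ {n} → 𝔽₂^ n
𝟎 = replicate _ false

_⊕_ : ∀ {n} → 𝔽₂^ n → 𝔽₂^ n → 𝔽₂^ n
_⊕_ = zipWith _xor_

record LinInj (a b : ℕ) : Set where
  field
    fun      : 𝔽₂^ a → 𝔽₂^ b
    additive : ∀ x y → fun (x ⊕ y) ≡ fun x ⊕ fun y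
    injective : ∀ x y → fun x ≡ fun y → x ≡ y
open LinInj public

-- A matroid on the projective space of dimension m: a {0,1}-valued function
-- (only its values on nonzero vectors are relevant).
Matroid : ℕ → Set
Matroid m = 𝔽₂^ m → Bool

-- A pattern of dimension a: values in {0,1,⋆}, with ⋆ = nothing.
Pattern : ℕ → Set
Pattern a = 𝔽₂^ a → Maybe Bool

IsInstance : ∀ {a m} → Pattern a → Matroid m → LinInj a m → Set
IsInstance N M φ = ∀ x → x ≢ 𝟎 → ∀ b → N x ≡ just b → M (fun φ x) ≡ b

Free : ∀ {a m} → Pattern a → Matroid m → Set
Free {a} {m} N M = (φ : LinInj a m) → IsInstance N M φ → Data.Empty.⊥
  where import Data.Empty

-- N' ∈ Ext^k(N): dim N' ≤ dim N + k, and N is isomorphic to the restriction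
-- of N' to a subspace of codimension ≤ k, i.e. there is a linear injection
-- ψ (onto that subspace) with N' ∘ ψ = N on nonzero vectors.
InExt : ∀ {a e} → ℕ → Pattern a → Pattern e → Set
InExt {a} {e} k N N' =
  e Data.Nat.≤ a Data.Nat.+ k ×
  Σ (LinInj a e) (λ ψ → ∀ x → x ≢ 𝟎 → N' (fun ψ x) ≡ N x)
  where open import Data.Product using (Σ; _×_)
        import Data.Nat

-- Work in coordinates: linear isomorphisms extending ι, φ and ψ (every linear injection extends to
-- one) give V ≅ 𝔽₂^a × 𝔽₂^r × 𝔽₂^k with W = {z = 0} and φ the inclusion of 𝔽₂^a, and N′ ≅ 𝔽₂^a × 𝔽₂^j
-- with ψ the inclusion of 𝔽₂^a, where a = dim N and j ≤ k.  For w ∈ 𝔽₂^s, s = r − j, the map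
-- (p , y) ↦ (p , w·y , y), with w·y a product of polynomials, embeds N′ in V and agrees with φ on N,
-- where M already shows the pattern N.  As 𝔽₂[X] has no zero divisors, the points with y ≠ 0 of
-- these 2^s embeddings form disjoint blocks of b ≤ 2^d points outside W.  An N′-free M″ extending M
-- must differ from N′ somewhere on every block, so there are at most (2^b − 1)^(2^s) · 2^R of them,
-- where 2^(n−k) + 2^s b + R ≤ 2^n.  Since n ≤ s + 2d and (1 − 2^−b)^(2^b) ≤ 1/2 this is at most
-- 2^(2^n (1 − 2^−k − ε)) for ε = 2^−(2^d + 2d).

module Submission where

open import Defs
open import Data.Bool using (Bool; true; false; _xor_; not)
open import Data.Bool.Properties using (¬-not; xor-assoc; xor-comm; xor-same; xor-identityˡ; xor-identityʳ)
  renaming (_≟_ to _≟ᵇ_)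
open import Data.Empty using (⊥-elim)
open import Data.List
  using (List; []; _∷_; [_]; map; concat; length; filter; zip; cartesianProduct; cartesianProductWith)
  renaming (_++_ to _++ₗ_)
open import Data.List.Membership.Propositional using (_∈_)
open import Data.List.Membership.Propositional.Properties
  using (∈-++⁺ˡ; ∈-++⁺ʳ; ∈-++⁻; ∈-map⁺; ∈-map⁻; ∈-∃++; ∈-filter⁺; ∈-filter⁻;
         ∈-cartesianProductWith⁺; ∈-cartesianProduct⁻)
open import Data.List.Properties using (length-map; length-++; length-filter; map-++; map-∘)
import Data.List.Properties as List
open import Data.List.Relation.Binary.Subset.Propositional using (_⊆_)
open import Data.List.Relation.Unary.All using (All; []; _∷_)
import Data.List.Relation.Unary.All as All
import Data.List.Relation.Unary.All.Properties as All
open import Data.List.Relation.Unary.Any using (Any; here; there)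
import Data.List.Relation.Unary.Any as Any
import Data.List.Relation.Unary.Any.Properties as Any
open import Data.List.Relation.Unary.Unique.Propositional using (Unique; []; _∷_)
import Data.List.Relation.Unary.Unique.Propositional.Properties as Unique
open import Data.Maybe using (just; fromMaybe)
open import Data.Nat using (ℕ; zero; suc; _+_; _*_; _^_; _∸_; _≤_; z≤n; s≤s; _≤?_)
open import Data.Nat.Properties
  using (+-suc; +-identityʳ; +-comm; +-assoc; +-cancelˡ-≤; +-cancelˡ-≡; *-comm; *-identityˡ;
         +-monoʳ-≤; +-monoˡ-≤; *-monoʳ-≤; *-monoˡ-≤; ^-monoʳ-≤; ^-monoˡ-≤; ∸-monoʳ-≤;
         ^-*-assoc; ^-distribˡ-+-*; m^n>0; suc-injective; ≤-reflexive; ≤-trans; ≰⇒≥; n≤1+n;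
         m≤m+n; m+n≤o⇒n≤o; m+n≤o⇒m≤o∸n; m∸n≤m; m≤n⇒m∸n≡0; m∸n+n≡m; m+n∸m≡n; m+[n∸m]≡n; m≤n+m∸n;
         module ≤-Reasoning)
open import Data.Nat.Tactic.RingSolver using (solve-∀)
open import Data.Product using (Σ; ∃₂; _×_; _,_; proj₁; proj₂; uncurry)
open import Data.Sum using (inj₁; inj₂)
open import Data.Vec using ([]; _∷_; _++_; take; drop; padRight; toList; fromList)
open import Data.Vec.Properties
  using (≡-dec; ∷-injectiveˡ; ∷-injectiveʳ; ++-injectiveˡ; ++-injectiveʳ; ++-injective; take++drop≡id;
         take-zipWith; drop-zipWith; zipWith-++; padRight-replicate; toList∘fromList)
open import Data.Vec.Relation.Binary.Pointwise.Inductive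
  using (Pointwise-≡⇒≡; zipWith-assoc; zipWith-comm; zipWith-identityˡ; zipWith-identityʳ)
open import Function using (_∘_; _∘′_)
open import Relation.Binary.Definitions using (DecidableEquality)
open import Relation.Binary.PropositionalEquality hiding ([_])
open import Relation.Nullary using (¬_; yes; no; ¬?)

-- Vectors over 𝔽₂

⊕-assoc : ∀ {n} (x y z : 𝔽₂^ n) → (x ⊕ y) ⊕ z ≡ x ⊕ (y ⊕ z)
⊕-assoc x y z = Pointwise-≡⇒≡ (zipWith-assoc xor-assoc x y z)

⊕-comm : ∀ {n} (x y : 𝔽₂^ n) → x ⊕ y ≡ y ⊕ x
⊕-comm x y = Pointwise-≡⇒≡ (zipWith-comm xor-comm x y)

⊕-identityˡ : ∀ {n} (x : 𝔽₂^ n) → 𝟎 ⊕ x ≡ x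
⊕-identityˡ x = Pointwise-≡⇒≡ (zipWith-identityˡ xor-identityˡ x)

⊕-identityʳ : ∀ {n} (x : 𝔽₂^ n) → x ⊕ 𝟎 ≡ x
⊕-identityʳ x = Pointwise-≡⇒≡ (zipWith-identityʳ xor-identityʳ x)

⊕-self : ∀ {n} (x : 𝔽₂^ n) → x ⊕ x ≡ 𝟎
⊕-self []      = refl
⊕-self (a ∷ x) = cong₂ _∷_ (xor-same a) (⊕-self x)

_≟ⱽ_ : ∀ {n} → DecidableEquality (𝔽₂^ n)
_≟ⱽ_ = ≡-dec _≟ᵇ_

⊕-interchange : ∀ {n} (a b c d : 𝔽₂^ n) → (a ⊕ b) ⊕ (c ⊕ d) ≡ (a ⊕ c) ⊕ (b ⊕ d)
⊕-interchange a b c d = begin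
  (a ⊕ b) ⊕ (c ⊕ d) ≡⟨ ⊕-assoc a b (c ⊕ d) ⟩
  a ⊕ (b ⊕ (c ⊕ d)) ≡⟨ cong (a ⊕_) (sym (⊕-assoc b c d)) ⟩
  a ⊕ ((b ⊕ c) ⊕ d) ≡⟨ cong (λ t → a ⊕ (t ⊕ d)) (⊕-comm b c) ⟩
  a ⊕ ((c ⊕ b) ⊕ d) ≡⟨ cong (a ⊕_) (⊕-assoc c b d) ⟩
  a ⊕ (c ⊕ (b ⊕ d)) ≡⟨ sym (⊕-assoc a c (b ⊕ d)) ⟩
  (a ⊕ c) ⊕ (b ⊕ d) ∎
  where open ≡-Reasoning

⊕-cancelʳ : ∀ {n} (x y : 𝔽₂^ n) → (x ⊕ y) ⊕ y ≡ x
⊕-cancelʳ x y = trans (⊕-assoc x y y) (trans (cong (x ⊕_) (⊕-self y)) (⊕-identityʳ x))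

⊕≡𝟎⇒≡ : ∀ {n} {x y : 𝔽₂^ n} → x ⊕ y ≡ 𝟎 → x ≡ y
⊕≡𝟎⇒≡ {x = x} {y} eq = trans (sym (⊕-cancelʳ x y)) (trans (cong (_⊕ y) eq) (⊕-identityˡ y))

⊕-++ : ∀ {m n} (a c : 𝔽₂^ m) (b d : 𝔽₂^ n) → (a ++ b) ⊕ (c ++ d) ≡ (a ⊕ c) ++ (b ⊕ d)
⊕-++ a c b d = zipWith-++ _xor_ a b c d

𝟎-++ : ∀ m {n} → 𝟎 {m + n} ≡ 𝟎 {m} ++ 𝟎 {n}
𝟎-++ zero    = refl
𝟎-++ (suc m) = cong (false ∷_) (𝟎-++ m)

Additive : ∀ {m n} → (𝔽₂^ m → 𝔽₂^ n) → Set
Additive f = ∀ x y → f (x ⊕ y) ≡ f x ⊕ f y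

additive⇒𝟎 : ∀ {m n} {f : 𝔽₂^ m → 𝔽₂^ n} → Additive f → f 𝟎 ≡ 𝟎
additive⇒𝟎 {f = f} f-⊕ = begin
  f 𝟎               ≡⟨ sym (⊕-cancelʳ (f 𝟎) (f 𝟎)) ⟩
  (f 𝟎 ⊕ f 𝟎) ⊕ f 𝟎 ≡⟨ cong (_⊕ f 𝟎) (sym (f-⊕ 𝟎 𝟎)) ⟩
  f (𝟎 ⊕ 𝟎) ⊕ f 𝟎   ≡⟨ cong (λ t → f t ⊕ f 𝟎) (⊕-self 𝟎) ⟩
  f 𝟎 ⊕ f 𝟎         ≡⟨ ⊕-self (f 𝟎) ⟩
  𝟎                 ∎
  where open ≡-Reasoning

𝔽₂^-trivial : ∀ {s} → s ≡ 0 → (w w′ : 𝔽₂^ s) → w ≡ w′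
𝔽₂^-trivial refl [] [] = refl

take-++ : ∀ {m n} (p : 𝔽₂^ m) (y : 𝔽₂^ n) → take m (p ++ y) ≡ p
take-++ []      y = refl
take-++ (x ∷ p) y = cong (x ∷_) (take-++ p y)

drop-++ : ∀ {m n} (p : 𝔽₂^ m) (y : 𝔽₂^ n) → drop m (p ++ y) ≡ y
drop-++ []      y = refl
drop-++ (x ∷ p) y = drop-++ p y

take-⊕ : ∀ m {n} (u v : 𝔽₂^ (m + n)) → take m (u ⊕ v) ≡ take m u ⊕ take m v
take-⊕ m = take-zipWith _xor_

drop-⊕ : ∀ m {n} (u v : 𝔽₂^ (m + n)) → drop m (u ⊕ v) ≡ drop m u ⊕ drop m v
drop-⊕ m = drop-zipWith _xor_

infixr 25 _·_

_·_ : ∀ {n} → Bool → 𝔽₂^ n → 𝔽₂^ n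
true  · v = v
false · v = 𝟎

·-distribʳ-xor : ∀ {n} a b (v : 𝔽₂^ n) → (a xor b) · v ≡ a · v ⊕ b · v
·-distribʳ-xor true  true  v = sym (⊕-self v)
·-distribʳ-xor true  false v = sym (⊕-identityʳ v)
·-distribʳ-xor false b     v = sym (⊕-identityˡ (b · v))

·-distribˡ-⊕ : ∀ {n} a (u v : 𝔽₂^ n) → a · (u ⊕ v) ≡ a · u ⊕ a · v
·-distribˡ-⊕ true  u v = refl
·-distribˡ-⊕ false u v = sym (⊕-self 𝟎)

-- Linear isomorphisms, and extension of linear injections to isomorphisms

record LinIso (m c : ℕ) : Set where
  field
    to      : 𝔽₂^ m → 𝔽₂^ c
    from    : 𝔽₂^ c → 𝔽₂^ m
    to-⊕    : Additive to
    from∘to : ∀ x → from (to x) ≡ x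
    to∘from : ∀ y → to (from y) ≡ y

  to-injective : ∀ {x y} → to x ≡ to y → x ≡ y
  to-injective {x} {y} eq = trans (sym (from∘to x)) (trans (cong from eq) (from∘to y))

  from-⊕ : Additive from
  from-⊕ x y = to-injective (begin
    to (from (x ⊕ y))          ≡⟨ to∘from (x ⊕ y) ⟩
    x ⊕ y                      ≡⟨ sym (cong₂ _⊕_ (to∘from x) (to∘from y)) ⟩
    to (from x) ⊕ to (from y)  ≡⟨ sym (to-⊕ (from x) (from y)) ⟩
    to (from x ⊕ from y)       ∎)
    where open ≡-Reasoning

  to-𝟎 : to 𝟎 ≡ 𝟎
  to-𝟎 = additive⇒𝟎 to-⊕

open LinIso

idIso : ∀ {m} → LinIso m m
idIso = record
  { to = λ x → x ; from = λ x → x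
  ; to-⊕ = λ _ _ → refl ; from∘to = λ _ → refl ; to∘from = λ _ → refl }

infixr 9 _∘ⁱ_

_∘ⁱ_ : ∀ {a b c} → LinIso b c → LinIso a b → LinIso a c
G ∘ⁱ F = record
  { to      = λ x → to G (to F x)
  ; from    = λ y → from F (from G y)
  ; to-⊕    = λ x y → trans (cong (to G) (to-⊕ F x y)) (to-⊕ G _ _)
  ; from∘to = λ x → trans (cong (from F) (from∘to G _)) (from∘to F x)
  ; to∘from = λ y → trans (cong (to G) (to∘from F _)) (to∘from G y) }

consIso : ∀ {m c} → LinIso m c → LinIso (suc m) (suc c)
consIso A = record
  { to      = λ { (h ∷ u) → h ∷ to A u }
  ; from    = λ { (h ∷ v) → h ∷ from A v }
  ; to-⊕    = λ { (h ∷ u) (h′ ∷ u′) → cong ((h xor h′) ∷_) (to-⊕ A u u′) }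
  ; from∘to = λ { (h ∷ u) → cong (h ∷_) (from∘to A u) }
  ; to∘from = λ { (h ∷ v) → cong (h ∷_) (to∘from A v) } }

swapIso : ∀ {m} → LinIso (suc (suc m)) (suc (suc m))
swapIso = record
  { to      = swap ; from = swap
  ; to-⊕    = λ { (a ∷ b ∷ u) (c ∷ d ∷ v) → refl }
  ; from∘to = λ { (a ∷ b ∷ u) → refl }
  ; to∘from = λ { (a ∷ b ∷ u) → refl } }
  where
  swap : ∀ {m} → 𝔽₂^ (suc (suc m)) → 𝔽₂^ (suc (suc m))
  swap (a ∷ b ∷ u) = b ∷ a ∷ u

shearIso : ∀ {m} → 𝔽₂^ m → LinIso (suc m) (suc m)
shearIso {m} t = record
  { to = shear ; from = shear ; to-⊕ = shear-⊕ ; from∘to = shear² ; to∘from = shear² }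
  where
  shear : 𝔽₂^ (suc m) → 𝔽₂^ (suc m)
  shear (h ∷ u) = h ∷ (u ⊕ h · t)

  shear² : ∀ v → shear (shear v) ≡ v
  shear² (h ∷ u) = cong (h ∷_) (⊕-cancelʳ u (h · t))

  shear-⊕ : Additive shear
  shear-⊕ (h ∷ u) (h′ ∷ u′) = cong ((h xor h′) ∷_) (begin
    (u ⊕ u′) ⊕ (h xor h′) · t      ≡⟨ cong ((u ⊕ u′) ⊕_) (·-distribʳ-xor h h′ t) ⟩
    (u ⊕ u′) ⊕ (h · t ⊕ h′ · t)    ≡⟨ ⊕-interchange u u′ (h · t) (h′ · t) ⟩
    (u ⊕ h · t) ⊕ (u′ ⊕ h′ · t)    ∎)
    where open ≡-Reasoning

e₁ : ∀ {m} → 𝔽₂^ (suc m)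
e₁ = true ∷ 𝟎

automorphism-e₁↦ : ∀ {m} (z : 𝔽₂^ (suc m)) → z ≢ 𝟎 → Σ (LinIso (suc m) (suc m)) λ A → to A e₁ ≡ z
automorphism-e₁↦ (true ∷ t) _ = shearIso t , cong (true ∷_) (⊕-identityˡ t)
automorphism-e₁↦ {zero} (false ∷ []) z≢𝟎 = ⊥-elim (z≢𝟎 refl)
automorphism-e₁↦ {suc m} (false ∷ t) z≢𝟎 =
  let A , Ae₁≡t = automorphism-e₁↦ t (z≢𝟎 ∘′ cong (false ∷_))
  in consIso A ∘ⁱ swapIso , cong (false ∷_) Ae₁≡t

prefixIso : ∀ a {m c} → LinIso m c → LinIso (a + m) (a + c)
prefixIso zero    A = A
prefixIso (suc a) A = consIso (prefixIso a A)

prefixIso-++ : ∀ {a m c} (A : LinIso m c) (p : 𝔽₂^ a) (v : 𝔽₂^ m) →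
               to (prefixIso a A) (p ++ v) ≡ p ++ to A v
prefixIso-++ A []      v = refl
prefixIso-++ A (x ∷ p) v = cong (x ∷_) (prefixIso-++ A p v)

rotateIso : ∀ a {b} → LinIso (suc (a + b)) (a + suc b)
rotateIso zero    = idIso
rotateIso (suc a) = consIso (rotateIso a) ∘ⁱ swapIso

rotateIso-++ : ∀ {a b} h (p : 𝔽₂^ a) (v : 𝔽₂^ b) → to (rotateIso a) (h ∷ (p ++ v)) ≡ p ++ (h ∷ v)
rotateIso-++ h []      v = refl
rotateIso-++ h (x ∷ p) v = cong (x ∷_) (rotateIso-++ h p v)

record Extension {a c} (f : 𝔽₂^ a → 𝔽₂^ c) : Set where
  constructor mkExtension
  field
    codim   : ℕ
    dim     : a + codim ≡ c
    iso     : LinIso (a + codim) c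
    extends : ∀ x → to iso (x ++ 𝟎) ≡ f x

open Extension

restrictTail : ∀ {a c} → LinInj (suc a) c → LinInj a c
restrictTail f = record
  { fun       = λ x → fun f (false ∷ x)
  ; additive  = λ x y → additive f (false ∷ x) (false ∷ y)
  ; injective = λ x y eq → ∷-injectiveʳ (injective f _ _ eq) }

-- drop a (from (iso G) v) ≡ 𝟎 would say that v lies in the image of the hyperplane x₁ = 0.
e₁-outside-hyperplane : ∀ {a c} (f : LinInj (suc a) c) (G : Extension (fun (restrictTail f))) →
                        drop a (from (iso G) (fun f e₁)) ≢ 𝟎
e₁-outside-hyperplane {a} f G t≡𝟎 = true≢false (∷-injectiveˡ (injective f _ _ (begin
  fun f e₁                                ≡⟨ sym (to∘from (iso G) (fun f e₁)) ⟩
  to (iso G) u                            ≡⟨ cong (to (iso G)) (sym (take++drop≡id a u)) ⟩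
  to (iso G) (take a u ++ drop a u)       ≡⟨ cong (λ t → to (iso G) (take a u ++ t)) t≡𝟎 ⟩
  to (iso G) (take a u ++ 𝟎)              ≡⟨ extends G (take a u) ⟩
  fun f (false ∷ take a u)                ∎)))
  where
  open ≡-Reasoning
  u : 𝔽₂^ (a + codim G)
  u = from (iso G) (fun f e₁)
  true≢false : true ≢ false
  true≢false ()

extension-step : ∀ {a c} (f : LinInj (suc a) c) → Extension (fun (restrictTail f)) → Extension (fun f)
extension-step f G@(mkExtension zero _ _ _) = ⊥-elim (e₁-outside-hyperplane f G (𝔽₂^-trivial refl _ 𝟎))
extension-step {a} {c} f G@(mkExtension (suc b) dimG isoG extendsG) =
  mkExtension b (trans (sym (+-suc a b)) dimG) F F-extends
  where
  u : 𝔽₂^ (a + suc b)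
  u = from isoG (fun f e₁)

  x₀ : 𝔽₂^ a
  x₀ = take a u

  t : 𝔽₂^ (suc b)
  t = drop a u

  A,Ae₁≡t : Σ (LinIso (suc b) (suc b)) λ A → to A e₁ ≡ t
  A,Ae₁≡t = automorphism-e₁↦ t (e₁-outside-hyperplane f G)

  A : LinIso (suc b) (suc b)
  A = proj₁ A,Ae₁≡t

  -- F sends (h , p , z) to G (p ⊕ h · x₀ , A (h ∷ z)), hence e₁ to G (x₀ , t) = f e₁.
  F : LinIso (suc a + b) c
  F = isoG ∘ⁱ prefixIso a A ∘ⁱ rotateIso a ∘ⁱ shearIso (x₀ ++ 𝟎)

  open ≡-Reasoning

  F-extends : ∀ x → to F (x ++ 𝟎) ≡ fun f x
  F-extends (false ∷ p) = begin
    to isoG (to (prefixIso a A) (to (rotateIso a) (false ∷ ((p ++ 𝟎) ⊕ 𝟎))))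
      ≡⟨ cong (λ v → to isoG (to (prefixIso a A) (to (rotateIso a) (false ∷ v)))) (⊕-identityʳ (p ++ 𝟎)) ⟩
    to isoG (to (prefixIso a A) (to (rotateIso a) (false ∷ (p ++ 𝟎))))
      ≡⟨ cong (λ v → to isoG (to (prefixIso a A) v)) (rotateIso-++ false p 𝟎) ⟩
    to isoG (to (prefixIso a A) (p ++ 𝟎))
      ≡⟨ cong (to isoG) (trans (prefixIso-++ A p 𝟎) (cong (p ++_) (to-𝟎 A))) ⟩
    to isoG (p ++ 𝟎)
      ≡⟨ extendsG p ⟩
    fun f (false ∷ p) ∎
  F-extends (true ∷ p) = begin
    to isoG (to (prefixIso a A) (to (rotateIso a) (true ∷ ((p ++ 𝟎) ⊕ (x₀ ++ 𝟎)))))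
      ≡⟨ cong (λ v → to isoG (to (prefixIso a A) (to (rotateIso a) (true ∷ v))))
              (trans (⊕-++ p x₀ 𝟎 𝟎) (cong ((p ⊕ x₀) ++_) (⊕-self 𝟎))) ⟩
    to isoG (to (prefixIso a A) (to (rotateIso a) (true ∷ ((p ⊕ x₀) ++ 𝟎))))
      ≡⟨ cong (λ v → to isoG (to (prefixIso a A) v)) (rotateIso-++ true (p ⊕ x₀) 𝟎) ⟩
    to isoG (to (prefixIso a A) ((p ⊕ x₀) ++ e₁))
      ≡⟨ cong (to isoG) (trans (prefixIso-++ A (p ⊕ x₀) e₁) (cong ((p ⊕ x₀) ++_) (proj₂ A,Ae₁≡t))) ⟩
    to isoG ((p ⊕ x₀) ++ t)
      ≡⟨ cong (λ v → to isoG ((p ⊕ x₀) ++ v)) (sym (⊕-identityˡ t)) ⟩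
    to isoG ((p ⊕ x₀) ++ (𝟎 ⊕ t))
      ≡⟨ cong (to isoG) (sym (⊕-++ p x₀ 𝟎 t)) ⟩
    to isoG ((p ++ 𝟎) ⊕ (x₀ ++ t))
      ≡⟨ to-⊕ isoG (p ++ 𝟎) (x₀ ++ t) ⟩
    to isoG (p ++ 𝟎) ⊕ to isoG (x₀ ++ t)
      ≡⟨ cong₂ _⊕_ (extendsG p) (trans (cong (to isoG) (take++drop≡id a u)) (to∘from isoG (fun f e₁))) ⟩
    fun f (false ∷ p) ⊕ fun f e₁
      ≡⟨ sym (additive f (false ∷ p) e₁) ⟩
    fun f (true ∷ (p ⊕ 𝟎))
      ≡⟨ cong (λ v → fun f (true ∷ v)) (⊕-identityʳ p) ⟩
    fun f (true ∷ p) ∎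

extension : ∀ {a c} (f : LinInj a c) → Extension (fun f)
extension {zero} {c} f = mkExtension c refl idIso (λ { [] → sym (additive⇒𝟎 (additive f)) })
extension {suc a} f    = extension-step f (extension (restrictTail f))

module _ {a c} {f : 𝔽₂^ a → 𝔽₂^ c} (E : Extension f) where

  extends-injective : ∀ {x y} → f x ≡ f y → x ≡ y
  extends-injective {x} {y} eq =
    ++-injectiveˡ x y (to-injective (iso E) (trans (extends E x) (trans eq (sym (extends E y)))))

  extends-𝟎 : f 𝟎 ≡ 𝟎
  extends-𝟎 = trans (sym (extends E 𝟎)) (trans (cong (to (iso E)) (sym (𝟎-++ a))) (to-𝟎 (iso E)))

  extends-≢𝟎 : ∀ {x} → x ≢ 𝟎 → f x ≢ 𝟎
  extends-≢𝟎 x≢𝟎 fx≡𝟎 = x≢𝟎 (extends-injective (trans fx≡𝟎 (sym extends-𝟎)))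

-- Truncated multiplication of polynomials over 𝔽₂

pad : ∀ {s r} → s ≤ r → 𝔽₂^ s → 𝔽₂^ r
pad s≤r = padRight s≤r false

pad-⊕ : ∀ {s r} (s≤r : s ≤ r) → Additive (pad s≤r)
pad-⊕ z≤n       []      []      = sym (⊕-self 𝟎)
pad-⊕ (s≤s s≤r) (x ∷ u) (y ∷ v) = cong ((x xor y) ∷_) (pad-⊕ s≤r u v)

pad-𝟎 : ∀ {s r} (s≤r : s ≤ r) → pad s≤r 𝟎 ≡ 𝟎
pad-𝟎 s≤r = sym (padRight-replicate s≤r false)

pad≡𝟎⇒≡𝟎 : ∀ {s r} (s≤r : s ≤ r) {u : 𝔽₂^ s} → pad s≤r u ≡ 𝟎 → u ≡ 𝟎
pad≡𝟎⇒≡𝟎 z≤n       {[]}    eq = refl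
pad≡𝟎⇒≡𝟎 (s≤s s≤r) {x ∷ u} eq = cong₂ _∷_ (∷-injectiveˡ eq) (pad≡𝟎⇒≡𝟎 s≤r (∷-injectiveʳ eq))

pad-injective : ∀ {s r} (s≤r : s ≤ r) {u v : 𝔽₂^ s} → pad s≤r u ≡ pad s≤r v → u ≡ v
pad-injective s≤r {u} {v} eq = ⊕≡𝟎⇒≡ (pad≡𝟎⇒≡𝟎 s≤r (begin
  pad s≤r (u ⊕ v)         ≡⟨ pad-⊕ s≤r u v ⟩
  pad s≤r u ⊕ pad s≤r v   ≡⟨ cong (_⊕ pad s≤r v) eq ⟩
  pad s≤r v ⊕ pad s≤r v   ≡⟨ ⊕-self (pad s≤r v) ⟩
  𝟎                       ∎))
  where open ≡-Reasoning

push : ∀ {n} → Bool → 𝔽₂^ n → 𝔽₂^ n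
push c []      = []
push c (x ∷ v) = c ∷ push x v

shift : ∀ {n} → 𝔽₂^ n → 𝔽₂^ n
shift = push false

push-⊕ : ∀ {n} c d (u v : 𝔽₂^ n) → push (c xor d) (u ⊕ v) ≡ push c u ⊕ push d v
push-⊕ c d []      []      = refl
push-⊕ c d (x ∷ u) (y ∷ v) = cong ((c xor d) ∷_) (push-⊕ x y u v)

shift-⊕ : ∀ {n} → Additive (shift {n})
shift-⊕ = push-⊕ false false

push-pad : ∀ {s r} c (s≤r : s ≤ r) (1+s≤r : suc s ≤ r) (u : 𝔽₂^ s) → push c (pad s≤r u) ≡ pad 1+s≤r (c ∷ u)
push-pad c z≤n       (s≤s z≤n)   []      = cong (c ∷_) (additive⇒𝟎 shift-⊕)
push-pad c (s≤s s≤r) (s≤s 1+s≤r) (x ∷ u) = cong (c ∷_) (push-pad x s≤r 1+s≤r u)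

-- The product of the polynomials w and y over 𝔽₂, truncated to the length r of w.
convolve : ∀ {r j} → 𝔽₂^ r → 𝔽₂^ j → 𝔽₂^ r
convolve w []      = 𝟎
convolve w (c ∷ y) = c · w ⊕ convolve (shift w) y

convolve-⊕ʳ : ∀ {r j} (w : 𝔽₂^ r) (y y′ : 𝔽₂^ j) → convolve w (y ⊕ y′) ≡ convolve w y ⊕ convolve w y′
convolve-⊕ʳ w []      []        = sym (⊕-self 𝟎)
convolve-⊕ʳ w (c ∷ y) (c′ ∷ y′) =
  trans (cong₂ _⊕_ (·-distribʳ-xor c c′ w) (convolve-⊕ʳ (shift w) y y′)) (⊕-interchange _ _ _ _)

convolve-⊕ˡ : ∀ {r j} (w w′ : 𝔽₂^ r) (y : 𝔽₂^ j) → convolve (w ⊕ w′) y ≡ convolve w y ⊕ convolve w′ y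
convolve-⊕ˡ w w′ []      = sym (⊕-self 𝟎)
convolve-⊕ˡ w w′ (c ∷ y) = begin
  c · (w ⊕ w′) ⊕ convolve (shift (w ⊕ w′)) y
    ≡⟨ cong₂ _⊕_ (·-distribˡ-⊕ c w w′) (cong (λ v → convolve v y) (shift-⊕ w w′)) ⟩
  (c · w ⊕ c · w′) ⊕ convolve (shift w ⊕ shift w′) y
    ≡⟨ cong ((c · w ⊕ c · w′) ⊕_) (convolve-⊕ˡ (shift w) (shift w′) y) ⟩
  (c · w ⊕ c · w′) ⊕ (convolve (shift w) y ⊕ convolve (shift w′) y)
    ≡⟨ ⊕-interchange _ _ _ _ ⟩
  convolve w (c ∷ y) ⊕ convolve w′ (c ∷ y) ∎
  where open ≡-Reasoning

convolve-𝟎ʳ : ∀ {r j} (w : 𝔽₂^ r) → convolve w (𝟎 {j}) ≡ 𝟎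
convolve-𝟎ʳ {j = zero}  w = refl
convolve-𝟎ʳ {j = suc j} w = trans (⊕-identityˡ _) (convolve-𝟎ʳ {j = j} (shift w))

-- w ≺ u : the first nonzero coordinate of w precedes every nonzero coordinate of u.
data _≺_ : ∀ {n} → 𝔽₂^ n → 𝔽₂^ n → Set where
  first : ∀ {n} {w u : 𝔽₂^ n} → (true ∷ w) ≺ (false ∷ u)
  later : ∀ {n} {w u : 𝔽₂^ n} → w ≺ u → (false ∷ w) ≺ (false ∷ u)

≺⇒≢𝟎 : ∀ {n} {w u : 𝔽₂^ n} → w ≺ u → w ≢ 𝟎
≺⇒≢𝟎 first     ()
≺⇒≢𝟎 (later p) eq = ≺⇒≢𝟎 p (∷-injectiveʳ eq)

≺⇒⊕≢𝟎 : ∀ {n} {w u : 𝔽₂^ n} → w ≺ u → w ⊕ u ≢ 𝟎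
≺⇒⊕≢𝟎 first     ()
≺⇒⊕≢𝟎 (later p) eq = ≺⇒⊕≢𝟎 p (∷-injectiveʳ eq)

≺-𝟎 : ∀ {n} {w : 𝔽₂^ n} → w ≢ 𝟎 → w ≺ 𝟎
≺-𝟎 {w = []}        w≢𝟎 = ⊥-elim (w≢𝟎 refl)
≺-𝟎 {w = true ∷ w}  w≢𝟎 = first
≺-𝟎 {w = false ∷ w} w≢𝟎 = later (≺-𝟎 (w≢𝟎 ∘′ cong (false ∷_)))

≺-shift : ∀ {n} {w : 𝔽₂^ n} → w ≢ 𝟎 → w ≺ shift w
≺-shift {w = []}        w≢𝟎 = ⊥-elim (w≢𝟎 refl)
≺-shift {w = true ∷ w}  w≢𝟎 = first
≺-shift {w = false ∷ w} w≢𝟎 = later (≺-shift (w≢𝟎 ∘′ cong (false ∷_)))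

≺-shiftʳ : ∀ {n} {w u : 𝔽₂^ n} → w ≺ u → w ≺ shift u
≺-shiftʳ first     = first
≺-shiftʳ (later p) = later (≺-shiftʳ p)

≺-⊕ʳ : ∀ {n} {w u u′ : 𝔽₂^ n} → w ≺ u → w ≺ u′ → w ≺ (u ⊕ u′)
≺-⊕ʳ first     first      = first
≺-⊕ʳ (later p) (later p′) = later (≺-⊕ʳ p p′)

≺-·ʳ : ∀ {n} {w u : 𝔽₂^ n} c → w ≺ u → w ≺ (c · u)
≺-·ʳ true  p = p
≺-·ʳ false p = ≺-𝟎 (≺⇒≢𝟎 p)

≺-convolveʳ : ∀ {n j} {w u : 𝔽₂^ n} (y : 𝔽₂^ j) → w ≺ u → w ≺ convolve u y
≺-convolveʳ []      p = ≺-𝟎 (≺⇒≢𝟎 p)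
≺-convolveʳ (c ∷ y) p = ≺-⊕ʳ (≺-·ʳ c p) (≺-convolveʳ y (≺-shiftʳ p))

-- A product of nonzero polynomials is nonzero; padding u of length t into r ≥ j + t ensures
-- that the truncation loses nothing.
convolve-pad≢𝟎 : ∀ {j t r} (y : 𝔽₂^ j) (u : 𝔽₂^ t) (t≤r : t ≤ r) → j + t ≤ r →
                 y ≢ 𝟎 → u ≢ 𝟎 → convolve (pad t≤r u) y ≢ 𝟎
convolve-pad≢𝟎 []           u t≤r j+t≤r y≢𝟎 u≢𝟎 = ⊥-elim (y≢𝟎 refl)
convolve-pad≢𝟎 {suc j} {t} {r} (false ∷ y) u t≤r j+t≤r y≢𝟎 u≢𝟎 eq =
  convolve-pad≢𝟎 y (false ∷ u) 1+t≤r j+1+t≤r (y≢𝟎 ∘′ cong (false ∷_)) (u≢𝟎 ∘′ ∷-injectiveʳ)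
    (trans (cong (λ v → convolve v y) (sym (push-pad false t≤r 1+t≤r u))) (trans (sym (⊕-identityˡ _)) eq))
  where
  j+1+t≤r : j + suc t ≤ r
  j+1+t≤r = subst (_≤ r) (sym (+-suc j t)) j+t≤r
  1+t≤r : suc t ≤ r
  1+t≤r = m+n≤o⇒n≤o j j+1+t≤r
convolve-pad≢𝟎 (true ∷ y) u t≤r j+t≤r y≢𝟎 u≢𝟎 =
  ≺⇒⊕≢𝟎 (≺-convolveʳ y (≺-shift (u≢𝟎 ∘′ pad≡𝟎⇒≡𝟎 t≤r)))

convolve-injectiveˡ : ∀ {r j} {w w′ : 𝔽₂^ (r ∸ j)} {y : 𝔽₂^ j} → y ≢ 𝟎 →
                      convolve (pad (m∸n≤m r j) w) y ≡ convolve (pad (m∸n≤m r j) w′) y → w ≡ w′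
convolve-injectiveˡ {r} {j} {w} {w′} {y} y≢𝟎 eq with j ≤? r | (w ⊕ w′) ≟ⱽ 𝟎
... | no  j≰r | _         = 𝔽₂^-trivial (m≤n⇒m∸n≡0 (≰⇒≥ j≰r)) w w′
... | yes _   | yes w⊕w′≡𝟎 = ⊕≡𝟎⇒≡ w⊕w′≡𝟎
... | yes j≤r | no  w⊕w′≢𝟎 =
  ⊥-elim (convolve-pad≢𝟎 y (w ⊕ w′) r∸j≤r (≤-reflexive (m+[n∸m]≡n j≤r)) y≢𝟎 w⊕w′≢𝟎 (begin
    convolve (pad r∸j≤r (w ⊕ w′)) y
      ≡⟨ cong (λ v → convolve v y) (pad-⊕ r∸j≤r w w′) ⟩
    convolve (pad r∸j≤r w ⊕ pad r∸j≤r w′) y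
      ≡⟨ convolve-⊕ˡ _ _ y ⟩
    convolve (pad r∸j≤r w) y ⊕ convolve (pad r∸j≤r w′) y
      ≡⟨ cong (_⊕ convolve (pad r∸j≤r w′) y) eq ⟩
    convolve (pad r∸j≤r w′) y ⊕ convolve (pad r∸j≤r w′) y
      ≡⟨ ⊕-self _ ⟩
    𝟎 ∎))
  where
  open ≡-Reasoning
  r∸j≤r : r ∸ j ≤ r
  r∸j≤r = m∸n≤m r j

-- Finite sets as lists

vectors : ∀ n → List (𝔽₂^ n)
vectors zero    = [ [] ]
vectors (suc n) = map (true ∷_) (vectors n) ++ₗ map (false ∷_) (vectors n)

∈-vectors : ∀ {n} (v : 𝔽₂^ n) → v ∈ vectors n
∈-vectors []          = here refl
∈-vectors (true ∷ v)  = ∈-++⁺ˡ (∈-map⁺ (true ∷_) (∈-vectors v))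
∈-vectors (false ∷ v) = ∈-++⁺ʳ (map (true ∷_) (vectors _)) (∈-map⁺ (false ∷_) (∈-vectors v))

vectors-unique : ∀ n → Unique (vectors n)
vectors-unique zero    = [] ∷ []
vectors-unique (suc n) =
  Unique.++⁺ (Unique.map⁺ ∷-injectiveʳ (vectors-unique n)) (Unique.map⁺ ∷-injectiveʳ (vectors-unique n))
             disjoint
  where
  disjoint : ∀ {v} → ¬ (v ∈ map (true ∷_) (vectors n) × v ∈ map (false ∷_) (vectors n))
  disjoint (p , q) with ∈-map⁻ (true ∷_) p | ∈-map⁻ (false ∷_) q
  ... | _ , _ , refl | _ , _ , ()

2^-suc : ∀ n → 2 ^ suc n ≡ 2 ^ n + 2 ^ n
2^-suc n = cong (2 ^ n +_) (+-identityʳ (2 ^ n))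

length-vectors : ∀ n → length (vectors n) ≡ 2 ^ n
length-vectors zero    = refl
length-vectors (suc n) = begin
  length (map (true ∷_) (vectors n) ++ₗ map (false ∷_) (vectors n))
    ≡⟨ length-++ (map (true ∷_) (vectors n)) ⟩
  length (map (true ∷_) (vectors n)) + length (map (false ∷_) (vectors n))
    ≡⟨ cong₂ _+_ (length-map _ (vectors n)) (length-map _ (vectors n)) ⟩
  length (vectors n) + length (vectors n)
    ≡⟨ cong₂ _+_ (length-vectors n) (length-vectors n) ⟩
  2 ^ n + 2 ^ n
    ≡⟨ sym (2^-suc n) ⟩
  2 ^ suc n ∎
  where open ≡-Reasoning

boolLists : ℕ → List (List Bool)
boolLists n = map toList (vectors n)

∈-boolLists : (u : List Bool) → u ∈ boolLists (length u)
∈-boolLists u = subst (_∈ boolLists (length u)) (toList∘fromList u) (∈-map⁺ toList (∈-vectors (fromList u)))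

length-boolLists : ∀ n → length (boolLists n) ≡ 2 ^ n
length-boolLists n = trans (length-map toList (vectors n)) (length-vectors n)

listsOtherThan : List Bool → List (List Bool)
listsOtherThan []      = []
listsOtherThan (x ∷ v) = map (x ∷_) (listsOtherThan v) ++ₗ map (not x ∷_) (boolLists (length v))

length-listsOtherThan : ∀ v → suc (length (listsOtherThan v)) ≡ 2 ^ length v
length-listsOtherThan []      = refl
length-listsOtherThan (x ∷ v) = begin
  suc (length (map (x ∷_) (listsOtherThan v) ++ₗ map (not x ∷_) (boolLists (length v))))
    ≡⟨ cong suc (length-++ (map (x ∷_) (listsOtherThan v))) ⟩
  suc (length (map (x ∷_) (listsOtherThan v)) + length (map (not x ∷_) (boolLists (length v))))
    ≡⟨ cong₂ (λ a b → suc (a + b)) (length-map _ (listsOtherThan v))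
             (trans (length-map _ (boolLists (length v))) (length-boolLists (length v))) ⟩
  suc (length (listsOtherThan v)) + 2 ^ length v
    ≡⟨ cong (_+ 2 ^ length v) (length-listsOtherThan v) ⟩
  2 ^ length v + 2 ^ length v
    ≡⟨ sym (2^-suc (length v)) ⟩
  2 ^ suc (length v) ∎
  where open ≡-Reasoning

∈-listsOtherThan : ∀ (u v : List Bool) → length u ≡ length v → u ≢ v → u ∈ listsOtherThan v
∈-listsOtherThan []      []      _  u≢v = ⊥-elim (u≢v refl)
∈-listsOtherThan (y ∷ u) (x ∷ v) eq u≢v with y ≟ᵇ x
... | yes refl = ∈-++⁺ˡ (∈-map⁺ (x ∷_) (∈-listsOtherThan u v (suc-injective eq) (u≢v ∘′ cong (x ∷_))))
... | no  y≢x  = ∈-++⁺ʳ (map (x ∷_) (listsOtherThan v))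
  (subst (λ z → (y ∷ u) ∈ map (z ∷_) (boolLists (length v))) (¬-not y≢x)
    (∈-map⁺ (y ∷_) (subst (λ n → u ∈ boolLists n) (suc-injective eq) (∈-boolLists u))))

length-cartesianProductWith : ∀ {A B C : Set} (f : A → B → C) (xs : List A) (ys : List B) →
                              length (cartesianProductWith f xs ys) ≡ length xs * length ys
length-cartesianProductWith f []       ys = refl
length-cartesianProductWith f (x ∷ xs) ys =
  trans (length-++ (map (f x) ys))
        (cong₂ _+_ (length-map (f x) ys) (length-cartesianProductWith f xs ys))

map-cartesianProduct : ∀ {A B C : Set} (g : A × B → C) (xs : List A) (ys : List B) →
                       map g (cartesianProduct xs ys) ≡ concat (map (λ x → map (λ y → g (x , y)) ys) xs)
map-cartesianProduct g []       ys = refl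
map-cartesianProduct g (x ∷ xs) ys =
  trans (map-++ g (map (x ,_) ys) _) (cong₂ _++ₗ_ (sym (map-∘ ys)) (map-cartesianProduct g xs ys))

tuples : ∀ {A : Set} → List A → ℕ → List (List A)
tuples L zero    = [ [] ]
tuples L (suc m) = cartesianProductWith _∷_ L (tuples L m)

length-tuples : ∀ {A : Set} (L : List A) m → length (tuples L m) ≡ length L ^ m
length-tuples L zero    = refl
length-tuples L (suc m) =
  trans (length-cartesianProductWith _∷_ L (tuples L m)) (cong (length L *_) (length-tuples L m))

∈-tuples : ∀ {A : Set} {L : List A} (xs : List A) → All (_∈ L) xs → xs ∈ tuples L (length xs)
∈-tuples []       []         = here refl
∈-tuples (x ∷ xs) (x∈L ∷ xs⊆L) = ∈-cartesianProductWith⁺ _∷_ x∈L (∈-tuples xs xs⊆L)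

Unique-⊆⇒length≤ : ∀ {A : Set} {xs ys : List A} → Unique xs → xs ⊆ ys → length xs ≤ length ys
Unique-⊆⇒length≤ {xs = []}     _             _     = z≤n
Unique-⊆⇒length≤ {xs = x ∷ xs} (x∉xs ∷ xs!) xs⊆ys with ∈-∃++ (xs⊆ys (here refl))
... | ys₁ , ys₂ , refl = begin
  suc (length xs)               ≤⟨ s≤s (Unique-⊆⇒length≤ xs! xs⊆ys₁ys₂) ⟩
  suc (length (ys₁ ++ₗ ys₂))    ≡⟨ cong suc (length-++ ys₁) ⟩
  suc (length ys₁ + length ys₂) ≡⟨ sym (+-suc (length ys₁) (length ys₂)) ⟩
  length ys₁ + suc (length ys₂) ≡⟨ sym (length-++ ys₁) ⟩
  length (ys₁ ++ₗ x ∷ ys₂)      ∎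
  where
  open ≤-Reasoning
  xs⊆ys₁ys₂ : xs ⊆ ys₁ ++ₗ ys₂
  xs⊆ys₁ys₂ {z} z∈xs with ∈-++⁻ ys₁ (xs⊆ys (there z∈xs))
  ... | inj₁ z∈ys₁         = ∈-++⁺ˡ z∈ys₁
  ... | inj₂ (here z≡x)    = ⊥-elim (All.lookup x∉xs z∈xs (sym z≡x))
  ... | inj₂ (there z∈ys₂) = ∈-++⁺ʳ ys₁ z∈ys₂

Unique-map⁺-injectiveOn : ∀ {A B : Set} {f : A → B} {xs : List A} →
                          (∀ {x y} → x ∈ xs → y ∈ xs → f x ≡ f y → x ≡ y) → Unique xs → Unique (map f xs)
Unique-map⁺-injectiveOn {xs = []}     _   []           = []
Unique-map⁺-injectiveOn {xs = x ∷ xs} inj (x∉xs ∷ xs!) =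
  All.map⁺ (All.tabulate λ z∈xs fx≡fz → All.lookup x∉xs z∈xs (inj (here refl) (there z∈xs) fx≡fz))
  ∷ Unique-map⁺-injectiveOn (λ p q → inj (there p) (there q)) xs!

zip-map-self : ∀ {A B : Set} (f : A → B) (xs : List A) → zip xs (map f xs) ≡ map (λ x → x , f x) xs
zip-map-self f []       = refl
zip-map-self f (x ∷ xs) = cong ((x , f x) ∷_) (zip-map-self f xs)

map≡map⇒≡ : ∀ {A B : Set} {f g : A → B} {xs : List A} → map f xs ≡ map g xs → ∀ {x} → x ∈ xs → f x ≡ g x
map≡map⇒≡ {xs = y ∷ xs} eq (here refl)  = proj₁ (List.∷-injective eq)
map≡map⇒≡ {xs = y ∷ xs} eq (there x∈xs) = map≡map⇒≡ (proj₂ (List.∷-injective eq)) x∈xs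

module _ {X : Set} (_≟_ : DecidableEquality X) where

  lookupKey : X → List (X × Bool) → Bool
  lookupKey y []            = false
  lookupKey y ((k , v) ∷ t) with y ≟ k
  ... | yes _ = v
  ... | no  _ = lookupKey y t

  lookupKey-sound : ∀ {y c} (t : List (X × Bool)) → Any (λ (k , _) → y ≡ k) t →
                    All (λ (k , v) → k ≡ y → v ≡ c) t → lookupKey y t ≡ c
  lookupKey-sound {y} ((k , v) ∷ t) y∈t (ok ∷ oks) with y ≟ k | y∈t
  ... | yes y≡k | _          = ok (sym y≡k)
  ... | no  y≢k | here y≡k   = ⊥-elim (y≢k y≡k)
  ... | no  _   | there y∈t′ = lookupKey-sound t y∈t′ oks

-- Arithmetic

^-distribʳ-* : ∀ x y n → (x * y) ^ n ≡ x ^ n * y ^ n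
^-distribʳ-* x y zero    = refl
^-distribʳ-* x y (suc n) = trans (cong ((x * y) *_) (^-distribʳ-* x y n)) (lemma x y (x ^ n) (y ^ n))
  where
  lemma : ∀ x y a b → x * y * (a * b) ≡ x * a * (y * b)
  lemma = solve-∀

binomial-lower : ∀ c n → c ^ suc n + suc n * c ^ n ≤ suc c ^ suc n
binomial-lower c zero    = ≤-reflexive (lemma c)
  where
  lemma : ∀ c → c * 1 + 1 * 1 ≡ (1 + c) * 1
  lemma = solve-∀
binomial-lower c (suc n) = begin
  c ^ suc (suc n) + suc (suc n) * c ^ suc n     ≡⟨ lemma₁ c n (c ^ n) ⟩
  c * x + (x + c * y)                           ≤⟨ +-monoʳ-≤ (c * x) (+-monoˡ-≤ (c * y) (m≤m+n x y)) ⟩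
  c * x + ((x + y) + c * y)                     ≡⟨ lemma₂ c x y ⟩
  suc c * (c ^ suc n + suc n * c ^ n)           ≤⟨ *-monoʳ-≤ (suc c) (binomial-lower c n) ⟩
  suc c * suc c ^ suc n                         ∎
  where
  open ≤-Reasoning
  x y : ℕ
  x = c * c ^ n
  y = suc n * c ^ n
  lemma₁ : ∀ c n a → c * (c * a) + (2 + n) * (c * a) ≡ c * (c * a) + (c * a + c * ((1 + n) * a))
  lemma₁ = solve-∀
  lemma₂ : ∀ c x y → c * x + ((x + y) + c * y) ≡ (1 + c) * (x + y)
  lemma₂ = solve-∀

-- (1 - 1/B) ^ B ≤ 1/2 for B = c + 1.
pred^≤half : ∀ c → c ^ suc c * 2 ≤ suc c ^ suc c
pred^≤half c = begin
  c ^ suc c * 2               ≡⟨ *-comm (c ^ suc c) 2 ⟩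
  c ^ suc c + (c ^ suc c + 0) ≡⟨ cong (c ^ suc c +_) (+-identityʳ _) ⟩
  c ^ suc c + c * c ^ c       ≤⟨ +-monoʳ-≤ (c ^ suc c) (*-monoˡ-≤ (c ^ c) (n≤1+n c)) ⟩
  c ^ suc c + suc c * c ^ c   ≤⟨ binomial-lower c c ⟩
  suc c ^ suc c               ∎
  where open ≤-Reasoning

-- By pred^≤half each of the m factors (2 ^ b ∸ 1) ^ (2 ^ b * t) is at most 2 ^ (b * 2 ^ b * t) / 2 ^ t,
-- and the m lost factors 2 ^ t pay for 2 ^ X.
counting-bound : ∀ b m R t X → X ≤ m * t →
                 ((2 ^ b ∸ 1) ^ m * 2 ^ R) ^ (2 ^ b * t) * 2 ^ X ≤ 2 ^ (2 ^ b * t * (m * b + R))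
counting-bound b m R t X X≤mt = begin
  (c ^ m * 2 ^ R) ^ q * 2 ^ X
    ≡⟨ cong (_* 2 ^ X) (^-distribʳ-* (c ^ m) (2 ^ R) q) ⟩
  (c ^ m) ^ q * (2 ^ R) ^ q * 2 ^ X
    ≡⟨ cong (λ z → z * (2 ^ R) ^ q * 2 ^ X) c^m^q≡c^B^mt ⟩
  (c ^ B) ^ (m * t) * (2 ^ R) ^ q * 2 ^ X
    ≡⟨ swap₂₃ ((c ^ B) ^ (m * t)) ((2 ^ R) ^ q) (2 ^ X) ⟩
  (c ^ B) ^ (m * t) * 2 ^ X * (2 ^ R) ^ q
    ≤⟨ *-monoˡ-≤ ((2 ^ R) ^ q) (*-monoʳ-≤ ((c ^ B) ^ (m * t)) (^-monoʳ-≤ 2 X≤mt)) ⟩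
  (c ^ B) ^ (m * t) * 2 ^ (m * t) * (2 ^ R) ^ q
    ≡⟨ cong (_* (2 ^ R) ^ q) (sym (^-distribʳ-* (c ^ B) 2 (m * t))) ⟩
  (c ^ B * 2) ^ (m * t) * (2 ^ R) ^ q
    ≤⟨ *-monoˡ-≤ ((2 ^ R) ^ q) (^-monoˡ-≤ (m * t) c^B*2≤B^B) ⟩
  (B ^ B) ^ (m * t) * (2 ^ R) ^ q
    ≡⟨ cong₂ _*_ (trans (cong (_^ (m * t)) (^-*-assoc 2 b B)) (^-*-assoc 2 (b * B) (m * t))) (^-*-assoc 2 R q) ⟩
  2 ^ (b * B * (m * t)) * 2 ^ (R * q)
    ≡⟨ sym (^-distribˡ-+-* 2 (b * B * (m * t)) (R * q)) ⟩
  2 ^ (b * B * (m * t) + R * q)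
    ≡⟨ cong (2 ^_) (exponents b B m t R) ⟩
  2 ^ (q * (m * b + R)) ∎
  where
  open ≤-Reasoning
  B c q : ℕ
  B = 2 ^ b
  c = B ∸ 1
  q = B * t

  B≡1+c : B ≡ suc c
  B≡1+c = sym (trans (+-comm 1 c) (m∸n+n≡m (m^n>0 2 b)))

  c^B*2≤B^B : c ^ B * 2 ≤ B ^ B
  c^B*2≤B^B = subst (λ z → c ^ z * 2 ≤ z ^ z) (sym B≡1+c) (pred^≤half c)

  swap₂₃ : ∀ x y z → x * y * z ≡ x * z * y
  swap₂₃ = solve-∀
  swap₁₂ : ∀ x y z → x * (y * z) ≡ y * (x * z)
  swap₁₂ = solve-∀

  c^m^q≡c^B^mt : (c ^ m) ^ q ≡ (c ^ B) ^ (m * t)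
  c^m^q≡c^B^mt = begin-equality
    (c ^ m) ^ (B * t) ≡⟨ ^-*-assoc c m (B * t) ⟩
    c ^ (m * (B * t)) ≡⟨ cong (c ^_) (swap₁₂ m B t) ⟩
    c ^ (B * (m * t)) ≡⟨ sym (^-*-assoc c B (m * t)) ⟩
    (c ^ B) ^ (m * t) ∎

  exponents : ∀ b B m t R → b * B * (m * t) + R * (B * t) ≡ B * t * (m * b + R)
  exponents = solve-∀

matroid-count-bound : ∀ {d n k s b R} → b ≤ 2 ^ d → n ≤ s + 2 * d → 2 ^ (n ∸ k) + 2 ^ s * b + R ≤ 2 ^ n →
                      ((2 ^ b ∸ 1) ^ (2 ^ s) * 2 ^ R) ^ (2 ^ (2 ^ d + 2 * d)) * 2 ^ (1 * 2 ^ n)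
                        ≤ 2 ^ (2 ^ (2 ^ d + 2 * d) * (2 ^ n ∸ 2 ^ (n ∸ k)))
matroid-count-bound {d} {n} {k} {s} {b} {R} b≤2^d n≤s+2d points≤ = begin
  L ^ 2 ^ D * 2 ^ (1 * 2 ^ n)         ≡⟨ cong₂ (λ q x → L ^ q * 2 ^ x) 2^D≡2^b*t (*-identityˡ (2 ^ n)) ⟩
  L ^ (2 ^ b * t) * 2 ^ 2 ^ n         ≤⟨ counting-bound b (2 ^ s) R t (2 ^ n) 2^n≤2^s*t ⟩
  2 ^ (2 ^ b * t * (2 ^ s * b + R))   ≡⟨ cong (λ q → 2 ^ (q * (2 ^ s * b + R))) (sym 2^D≡2^b*t) ⟩
  2 ^ (2 ^ D * (2 ^ s * b + R))       ≤⟨ ^-monoʳ-≤ 2 (*-monoʳ-≤ (2 ^ D) blocks+rest≤) ⟩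
  2 ^ (2 ^ D * (2 ^ n ∸ 2 ^ (n ∸ k))) ∎
  where
  open ≤-Reasoning
  L D t : ℕ
  L = (2 ^ b ∸ 1) ^ (2 ^ s) * 2 ^ R
  D = 2 ^ d + 2 * d
  t = 2 ^ (D ∸ b)

  b≤D : b ≤ D
  b≤D = ≤-trans b≤2^d (m≤m+n (2 ^ d) (2 * d))

  2^D≡2^b*t : 2 ^ D ≡ 2 ^ b * t
  2^D≡2^b*t = trans (cong (2 ^_) (sym (m+[n∸m]≡n b≤D))) (^-distribˡ-+-* 2 b (D ∸ b))

  2d≤D∸b : 2 * d ≤ D ∸ b
  2d≤D∸b = ≤-trans (≤-reflexive (sym (m+n∸m≡n (2 ^ d) (2 * d)))) (∸-monoʳ-≤ D b≤2^d)

  2^n≤2^s*t : 2 ^ n ≤ 2 ^ s * t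
  2^n≤2^s*t = subst (2 ^ n ≤_) (^-distribˡ-+-* 2 s (D ∸ b))
                    (^-monoʳ-≤ 2 (≤-trans n≤s+2d (+-monoʳ-≤ s 2d≤D∸b)))

  blocks+rest≤ : 2 ^ s * b + R ≤ 2 ^ n ∸ 2 ^ (n ∸ k)
  blocks+rest≤ = m+n≤o⇒m≤o∸n (2 ^ s * b + R)
    (subst (_≤ 2 ^ n) (trans (+-assoc (2 ^ (n ∸ k)) (2 ^ s * b) R) (+-comm (2 ^ (n ∸ k)) _)) points≤)

dimension-bound : ∀ {a r k j n} → a + r + k ≡ n → j ≤ k → n ≤ (r ∸ j) + 2 * (a + k)
dimension-bound {a} {r} {k} {j} {n} dims j≤k = begin
  n                         ≡⟨ sym dims ⟩
  a + r + k                 ≤⟨ +-monoˡ-≤ k (+-monoʳ-≤ a (m≤n+m∸n r j)) ⟩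
  a + (j + (r ∸ j)) + k     ≤⟨ +-monoˡ-≤ k (+-monoʳ-≤ a (+-monoˡ-≤ (r ∸ j) j≤k)) ⟩
  a + (k + (r ∸ j)) + k     ≤⟨ m≤m+n _ a ⟩
  a + (k + (r ∸ j)) + k + a ≡⟨ rearrange a k (r ∸ j) ⟩
  (r ∸ j) + 2 * (a + k)     ∎
  where
  open ≤-Reasoning
  rearrange : ∀ a k s → a + (k + s) + k + a ≡ s + 2 * (a + k)
  rearrange = solve-∀

-- The embeddings and the count

-- Via I and Φ a point of V has coordinates (p , t , z) ∈ 𝔽₂^a × 𝔽₂^r × 𝔽₂^k and via Ψ a point x of N′
-- has coordinates (P x , Y x) ∈ 𝔽₂^a × 𝔽₂^j; in these coordinates χ w is (p , y) ↦ (p , L w y , y).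
module Embeddings {m n a e} {ι : 𝔽₂^ m → 𝔽₂^ n} {φ : 𝔽₂^ a → 𝔽₂^ m} {ψ : 𝔽₂^ a → 𝔽₂^ e}
                  (Eι : Extension ι) (Eφ : Extension φ) (Eψ : Extension ψ)
                  (j≤k : codim Eψ ≤ codim Eι) where

  open import Data.List.Membership.DecPropositional (_≟ⱽ_ {n}) using (_∈?_; _∉?_)

  j r s : ℕ
  j = codim Eψ
  r = codim Eφ
  s = r ∸ j

  I : LinIso (m + codim Eι) n
  I = iso Eι

  Φ : LinIso (a + r) m
  Φ = iso Eφ

  Ψ : LinIso (a + j) e
  Ψ = iso Eψ

  P : 𝔽₂^ e → 𝔽₂^ a
  P x = take a (from Ψ x)

  Y : 𝔽₂^ e → 𝔽₂^ j
  Y x = drop a (from Ψ x)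

  P-⊕ : Additive P
  P-⊕ x y = trans (cong (take a) (from-⊕ Ψ x y)) (take-⊕ a _ _)

  Y-⊕ : Additive Y
  Y-⊕ x y = trans (cong (drop a) (from-⊕ Ψ x y)) (drop-⊕ a _ _)

  Ψ-coordinates : ∀ x → to Ψ (P x ++ Y x) ≡ x
  Ψ-coordinates x = trans (cong (to Ψ) (take++drop≡id a (from Ψ x))) (to∘from Ψ x)

  P,Y-injective : ∀ {x x′} → P x ≡ P x′ → Y x ≡ Y x′ → x ≡ x′
  P,Y-injective {x} {x′} P≡ Y≡ =
    trans (sym (Ψ-coordinates x)) (trans (cong₂ (λ p y → to Ψ (p ++ y)) P≡ Y≡) (Ψ-coordinates x′))

  Y≡𝟎⇒≡ψP : ∀ {x} → Y x ≡ 𝟎 → x ≡ ψ (P x)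
  Y≡𝟎⇒≡ψP {x} Y≡𝟎 =
    trans (sym (Ψ-coordinates x)) (trans (cong (λ y → to Ψ (P x ++ y)) Y≡𝟎) (extends Eψ (P x)))

  from-ψ : ∀ p → from Ψ (ψ p) ≡ p ++ 𝟎
  from-ψ p = trans (cong (from Ψ) (sym (extends Eψ p))) (from∘to Ψ (p ++ 𝟎))

  L : 𝔽₂^ s → 𝔽₂^ j → 𝔽₂^ r
  L w y = convolve (pad (m∸n≤m r j) w) y

  χ : 𝔽₂^ s → 𝔽₂^ e → 𝔽₂^ n
  χ w x = to I (to Φ (P x ++ L w (Y x)) ++ pad j≤k (Y x))

  χ-⊕ : ∀ w → Additive (χ w)
  χ-⊕ w x y = begin
    to I (to Φ (P (x ⊕ y) ++ L w (Y (x ⊕ y))) ++ pad j≤k (Y (x ⊕ y)))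
      ≡⟨ cong₂ (λ p z → to I (to Φ (p ++ L w z) ++ pad j≤k z)) (P-⊕ x y) (Y-⊕ x y) ⟩
    to I (to Φ ((P x ⊕ P y) ++ L w (Y x ⊕ Y y)) ++ pad j≤k (Y x ⊕ Y y))
      ≡⟨ cong₂ (λ t z → to I (to Φ ((P x ⊕ P y) ++ t) ++ z)) (convolve-⊕ʳ _ (Y x) (Y y)) (pad-⊕ j≤k (Y x) (Y y)) ⟩
    to I (to Φ ((P x ⊕ P y) ++ (L w (Y x) ⊕ L w (Y y))) ++ (pad j≤k (Y x) ⊕ pad j≤k (Y y)))
      ≡⟨ cong (λ t → to I (to Φ t ++ _)) (sym (⊕-++ (P x) (P y) _ _)) ⟩
    to I (to Φ ((P x ++ L w (Y x)) ⊕ (P y ++ L w (Y y))) ++ (pad j≤k (Y x) ⊕ pad j≤k (Y y)))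
      ≡⟨ cong (λ t → to I (t ++ _)) (to-⊕ Φ _ _) ⟩
    to I ((to Φ (P x ++ L w (Y x)) ⊕ to Φ (P y ++ L w (Y y))) ++ (pad j≤k (Y x) ⊕ pad j≤k (Y y)))
      ≡⟨ cong (to I) (sym (⊕-++ (to Φ (P x ++ L w (Y x))) _ (pad j≤k (Y x)) _)) ⟩
    to I ((to Φ (P x ++ L w (Y x)) ++ pad j≤k (Y x)) ⊕ (to Φ (P y ++ L w (Y y)) ++ pad j≤k (Y y)))
      ≡⟨ to-⊕ I _ _ ⟩
    χ w x ⊕ χ w y ∎
    where open ≡-Reasoning

  χ≡χ⇒ : ∀ {w w′ x x′} → χ w x ≡ χ w′ x′ → P x ≡ P x′ × Y x ≡ Y x′ × L w (Y x) ≡ L w′ (Y x′)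
  χ≡χ⇒ eq =
    let Φ-part≡ , pad≡ = ++-injective _ _ (to-injective I eq)
        P≡ , L≡        = ++-injective _ _ (to-injective Φ Φ-part≡)
    in P≡ , pad-injective j≤k pad≡ , L≡

  χ-injective : ∀ w x x′ → χ w x ≡ χ w x′ → x ≡ x′
  χ-injective w x x′ eq = let P≡ , Y≡ , _ = χ≡χ⇒ eq in P,Y-injective P≡ Y≡

  embedding : 𝔽₂^ s → LinInj e n
  embedding w = record { fun = χ w ; additive = χ-⊕ w ; injective = χ-injective w }

  χ-ψ : ∀ w p → χ w (ψ p) ≡ ι (φ p)
  χ-ψ w p = begin
    to I (to Φ (P (ψ p) ++ L w (Y (ψ p))) ++ pad j≤k (Y (ψ p)))
      ≡⟨ cong₂ (λ q y → to I (to Φ (q ++ L w y) ++ pad j≤k y))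
               (trans (cong (take a) (from-ψ p)) (take-++ p 𝟎)) (trans (cong (drop a) (from-ψ p)) (drop-++ p 𝟎)) ⟩
    to I (to Φ (p ++ L w 𝟎) ++ pad j≤k 𝟎)
      ≡⟨ cong₂ (λ t z → to I (to Φ (p ++ t) ++ z)) (convolve-𝟎ʳ {j = j} (pad (m∸n≤m r j) w)) (pad-𝟎 j≤k) ⟩
    to I (to Φ (p ++ 𝟎) ++ 𝟎)
      ≡⟨ cong (λ t → to I (t ++ 𝟎)) (extends Eφ p) ⟩
    to I (φ p ++ 𝟎)
      ≡⟨ extends Eι (φ p) ⟩
    ι (φ p) ∎
    where open ≡-Reasoning

  ι≢χ : ∀ {u w x} → Y x ≢ 𝟎 → ι u ≢ χ w x
  ι≢χ {u} Y≢𝟎 eq =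
    Y≢𝟎 (pad≡𝟎⇒≡𝟎 j≤k (sym (++-injectiveʳ u _ (to-injective I (trans (extends Eι u) eq)))))

  χ-injective₂ : ∀ {w w′ x x′} → Y x ≢ 𝟎 → χ w x ≡ χ w′ x′ → w ≡ w′ × x ≡ x′
  χ-injective₂ {w} {w′} {x} Y≢𝟎 eq =
    let P≡ , Y≡ , L≡ = χ≡χ⇒ eq
    in convolve-injectiveˡ Y≢𝟎 (trans L≡ (cong (L w′) (sym Y≡))) , P,Y-injective P≡ Y≡

  outsideψ : List (𝔽₂^ e)
  outsideψ = filter (λ x → ¬? (Y x ≟ⱽ 𝟎)) (vectors e)

  ∈outsideψ⇒Y≢𝟎 : ∀ {x} → x ∈ outsideψ → Y x ≢ 𝟎
  ∈outsideψ⇒Y≢𝟎 x∈outsideψ = proj₂ (∈-filter⁻ (λ x → ¬? (Y x ≟ⱽ 𝟎)) {xs = vectors e} x∈outsideψ)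

  Wpoints : List (𝔽₂^ n)
  Wpoints = map ι (vectors m)

  pairs : List (𝔽₂^ s × 𝔽₂^ e)
  pairs = cartesianProduct (vectors s) outsideψ

  ∈pairs⇒Y≢𝟎 : ∀ {w x} → (w , x) ∈ pairs → Y x ≢ 𝟎
  ∈pairs⇒Y≢𝟎 wx∈ = ∈outsideψ⇒Y≢𝟎 (proj₂ (∈-cartesianProduct⁻ (vectors s) outsideψ wx∈))

  blockPoints : List (𝔽₂^ n)
  blockPoints = map (uncurry χ) pairs

  restPoints : List (𝔽₂^ n)
  restPoints = filter (_∉? Wpoints ++ₗ blockPoints) (vectors n)

  ∈blockPoints⇒ : ∀ {y} → y ∈ blockPoints → ∃₂ λ w x → Y x ≢ 𝟎 × y ≡ χ w x
  ∈blockPoints⇒ y∈blockPoints with ∈-map⁻ (uncurry χ) y∈blockPoints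
  ... | (w , x) , wx∈ , refl = w , x , ∈pairs⇒Y≢𝟎 wx∈ , refl

  Wpoints++blockPoints-unique : Unique (Wpoints ++ₗ blockPoints)
  Wpoints++blockPoints-unique = Unique.++⁺
    (Unique.map⁺ (extends-injective Eι) (vectors-unique m))
    (Unique-map⁺-injectiveOn χ-injectiveOn
      (Unique.cartesianProduct⁺ (vectors-unique s) (Unique.filter⁺ _ (vectors-unique e))))
    W∩B≡∅
    where
    χ-injectiveOn : ∀ {wx wx′} → wx ∈ pairs → wx′ ∈ pairs → uncurry χ wx ≡ uncurry χ wx′ → wx ≡ wx′
    χ-injectiveOn {w , x} wx∈ _ eq = let w≡ , x≡ = χ-injective₂ (∈pairs⇒Y≢𝟎 wx∈) eq in cong₂ _,_ w≡ x≡
    W∩B≡∅ : ∀ {y} → ¬ (y ∈ Wpoints × y ∈ blockPoints)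
    W∩B≡∅ (y∈W , y∈B) with ∈-map⁻ ι y∈W | ∈blockPoints⇒ y∈B
    ... | u , _ , refl | w , x , Y≢𝟎 , ιu≡χwx = ι≢χ Y≢𝟎 ιu≡χwx

  points-count : 2 ^ m + 2 ^ s * length outsideψ + length restPoints ≤ 2 ^ n
  points-count = subst₂ _≤_ lengths (length-vectors n)
    (Unique-⊆⇒length≤ all-unique (λ {y} _ → ∈-vectors y))
    where
    all-unique : Unique ((Wpoints ++ₗ blockPoints) ++ₗ restPoints)
    all-unique = Unique.++⁺ Wpoints++blockPoints-unique (Unique.filter⁺ _ (vectors-unique n))
      λ (y∈WB , y∈R) → proj₂ (∈-filter⁻ (_∉? Wpoints ++ₗ blockPoints) {xs = vectors n} y∈R) y∈WB
    lengths : length ((Wpoints ++ₗ blockPoints) ++ₗ restPoints) ≡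
              2 ^ m + 2 ^ s * length outsideψ + length restPoints
    lengths = begin
      length ((Wpoints ++ₗ blockPoints) ++ₗ restPoints)
        ≡⟨ length-++ (Wpoints ++ₗ blockPoints) ⟩
      length (Wpoints ++ₗ blockPoints) + length restPoints
        ≡⟨ cong (_+ length restPoints) (length-++ Wpoints) ⟩
      length Wpoints + length blockPoints + length restPoints
        ≡⟨ cong₂ (λ p q → p + q + length restPoints) |W| |B| ⟩
      2 ^ m + 2 ^ s * length outsideψ + length restPoints ∎
      where
      open ≡-Reasoning
      |W| : length Wpoints ≡ 2 ^ m
      |W| = trans (length-map ι (vectors m)) (length-vectors m)
      |B| : length blockPoints ≡ 2 ^ s * length outsideψ
      |B| = trans (length-map (uncurry χ) pairs)
                  (trans (length-cartesianProductWith _,_ (vectors s) outsideψ)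
                         (cong (_* length outsideψ) (length-vectors s)))

  module Candidates (M : Matroid m) (N′ : Pattern e) where

    -- A ⋆ of N′ is read as 0: excluding this single pattern on every block already gives the bound.
    forbidden : List Bool
    forbidden = map (fromMaybe false ∘ N′) outsideψ

    block : Matroid n → 𝔽₂^ s → List Bool
    block M″ w = map (M″ ∘ χ w) outsideψ

    candidates : List (List Bool)
    candidates = cartesianProductWith (λ bs rs → concat bs ++ₗ rs)
                   (tuples (listsOtherThan forbidden) (2 ^ s)) (boolLists (length restPoints))

    Wtable : List (𝔽₂^ n × Bool)
    Wtable = map (λ u → ι u , M u) (vectors m)

    matroidOf : List Bool → Matroid n
    matroidOf c y = lookupKey _≟ⱽ_ y (Wtable ++ₗ zip (blockPoints ++ₗ restPoints) c)

    Ms : List (Matroid n)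
    Ms = map matroidOf candidates

    length-Ms : length Ms ≡ (2 ^ length outsideψ ∸ 1) ^ (2 ^ s) * 2 ^ length restPoints
    length-Ms = begin
      length Ms
        ≡⟨ length-map matroidOf candidates ⟩
      length candidates
        ≡⟨ length-cartesianProductWith _ (tuples (listsOtherThan forbidden) (2 ^ s)) _ ⟩
      length (tuples (listsOtherThan forbidden) (2 ^ s)) * length (boolLists (length restPoints))
        ≡⟨ cong₂ _*_ (length-tuples (listsOtherThan forbidden) (2 ^ s)) (length-boolLists (length restPoints)) ⟩
      length (listsOtherThan forbidden) ^ (2 ^ s) * 2 ^ length restPoints
        ≡⟨ cong (λ l → l ^ (2 ^ s) * 2 ^ length restPoints) |others| ⟩
      (2 ^ length outsideψ ∸ 1) ^ (2 ^ s) * 2 ^ length restPoints ∎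
      where
      open ≡-Reasoning
      |others| : length (listsOtherThan forbidden) ≡ 2 ^ length outsideψ ∸ 1
      |others| = trans (cong (_∸ 1) (length-listsOtherThan forbidden))
                       (cong (λ l → 2 ^ l ∸ 1) (length-map (fromMaybe false ∘ N′) outsideψ))

    table : (𝔽₂^ n → Bool) → List (𝔽₂^ n × Bool)
    table g = Wtable ++ₗ map (λ z → z , g z) (blockPoints ++ₗ restPoints)

    ∈keys : ∀ g y → Any (λ (k , _) → y ≡ k) (table g)
    ∈keys g y with y ∈? Wpoints ++ₗ blockPoints
    ... | no  y∉WB = Any.++⁺ʳ Wtable (Any.map⁺ (∈-++⁺ʳ blockPoints y∈R))
      where
      y∈R : y ∈ restPoints
      y∈R = ∈-filter⁺ (_∉? Wpoints ++ₗ blockPoints) (∈-vectors y) y∉WB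
    ... | yes y∈WB with ∈-++⁻ Wpoints y∈WB
    ...   | inj₁ y∈W = Any.++⁺ˡ (Any.map⁺ (Any.map⁻ y∈W))
    ...   | inj₂ y∈B = Any.++⁺ʳ Wtable (Any.map⁺ (∈-++⁺ˡ y∈B))

    module _ (M″ : Matroid n) (agree : ∀ u → u ≢ 𝟎 → M″ (ι u) ≡ M u) where

      restriction : List Bool
      restriction = map M″ (blockPoints ++ₗ restPoints)

      restriction∈candidates : (∀ w → block M″ w ≢ forbidden) → restriction ∈ candidates
      restriction∈candidates blocks≢ =
        subst (_∈ candidates) (sym restriction≡) (∈-cartesianProductWith⁺ _ blocks∈ rest∈)
        where
        blocks : List (List Bool)
        blocks = map (block M″) (vectors s)

        restriction≡ : restriction ≡ concat blocks ++ₗ map M″ restPoints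
        restriction≡ = trans (map-++ M″ blockPoints restPoints) (cong (_++ₗ map M″ restPoints)
          (trans (sym (map-∘ pairs))
                 (map-cartesianProduct (M″ ∘ uncurry χ) (vectors s) outsideψ)))

        blocks∈ : blocks ∈ tuples (listsOtherThan forbidden) (2 ^ s)
        blocks∈ = subst (λ l → blocks ∈ tuples (listsOtherThan forbidden) l)
                        (trans (length-map (block M″) (vectors s)) (length-vectors s))
                        (∈-tuples blocks (All.map⁺ (All.tabulate λ {w} _ →
                          ∈-listsOtherThan (block M″ w) forbidden
                            (trans (length-map _ outsideψ) (sym (length-map _ outsideψ))) (blocks≢ w))))

        rest∈ : map M″ restPoints ∈ boolLists (length restPoints)
        rest∈ = subst (λ l → map M″ restPoints ∈ boolLists l) (length-map M″ restPoints)
                      (∈-boolLists (map M″ restPoints))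

      matroidOf-restriction : ∀ y → y ≢ 𝟎 → M″ y ≡ matroidOf restriction y
      matroidOf-restriction y y≢𝟎 = sym (begin
        lookupKey _≟ⱽ_ y (Wtable ++ₗ zip (blockPoints ++ₗ restPoints) restriction)
          ≡⟨ cong (λ t → lookupKey _≟ⱽ_ y (Wtable ++ₗ t)) (zip-map-self M″ (blockPoints ++ₗ restPoints)) ⟩
        lookupKey _≟ⱽ_ y (table M″)
          ≡⟨ lookupKey-sound _≟ⱽ_ (table M″) (∈keys M″ y) entries-ok ⟩
        M″ y ∎)
        where
        open ≡-Reasoning
        ιu≡y⇒u≢𝟎 : ∀ {u} → ι u ≡ y → u ≢ 𝟎
        ιu≡y⇒u≢𝟎 ιu≡y u≡𝟎 = y≢𝟎 (trans (sym ιu≡y) (trans (cong ι u≡𝟎) (extends-𝟎 Eι)))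

        entries-ok : All (λ (k , v) → k ≡ y → v ≡ M″ y) (table M″)
        entries-ok = All.++⁺ {xs = Wtable}
          (All.map⁺ {xs = vectors m} (All.tabulate λ {u} _ ιu≡y →
            trans (sym (agree u (ιu≡y⇒u≢𝟎 ιu≡y))) (cong M″ ιu≡y)))
          (All.map⁺ {xs = blockPoints ++ₗ restPoints} (All.tabulate λ _ → cong M″))

      cover : (∀ w → block M″ w ≢ forbidden) → Any (λ M₀ → ∀ y → y ≢ 𝟎 → M″ y ≡ M₀ y) Ms
      cover blocks≢ = Any.map⁺ (Any.map (λ { refl → matroidOf-restriction }) (restriction∈candidates blocks≢))

      block≡forbidden⇒instance : (N : Pattern a) → (∀ p → p ≢ 𝟎 → ∀ c → N p ≡ just c → M (φ p) ≡ c) →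
                                 (∀ p → p ≢ 𝟎 → N′ (ψ p) ≡ N p) →
                                 ∀ w → block M″ w ≡ forbidden → IsInstance N′ M″ (embedding w)
      block≡forbidden⇒instance N φ-instance ψ-restricts w block≡ x x≢𝟎 c N′x≡c with Y x ≟ⱽ 𝟎
      ... | no Y≢𝟎 =
        trans (map≡map⇒≡ block≡ (∈-filter⁺ (λ x → ¬? (Y x ≟ⱽ 𝟎)) (∈-vectors x) Y≢𝟎)) (cong (fromMaybe false) N′x≡c)
      ... | yes Y≡𝟎 = begin
        M″ (χ w x)       ≡⟨ cong M″ (trans (cong (χ w) x≡ψp) (χ-ψ w p)) ⟩
        M″ (ι (φ p))     ≡⟨ agree (φ p) (extends-≢𝟎 Eφ p≢𝟎) ⟩
        M (φ p)          ≡⟨ φ-instance p p≢𝟎 c Np≡c ⟩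
        c                ∎
        where
        open ≡-Reasoning
        p : 𝔽₂^ a
        p = P x
        x≡ψp : x ≡ ψ p
        x≡ψp = Y≡𝟎⇒≡ψP Y≡𝟎
        p≢𝟎 : p ≢ 𝟎
        p≢𝟎 p≡𝟎 = x≢𝟎 (trans x≡ψp (trans (cong ψ p≡𝟎) (extends-𝟎 Eψ)))
        Np≡c : N p ≡ just c
        Np≡c = trans (sym (ψ-restricts p p≢𝟎)) (trans (cong N′ (sym x≡ψp)) N′x≡c)

few-free-extensions :
  ∀ d n k → d ≤ n → k ≤ d →
  (ι : LinInj (n ∸ k) n) (N : Pattern (d ∸ k)) (M : Matroid (n ∸ k)) →
  Σ (LinInj (d ∸ k) (n ∸ k)) (IsInstance N M) →
  (e : ℕ) (N′ : Pattern e) → InExt k N N′ →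
  Σ (List (Matroid n)) λ Ms →
    length Ms ^ 2 ^ (2 ^ d + 2 * d) * 2 ^ (1 * 2 ^ n) ≤ 2 ^ (2 ^ (2 ^ d + 2 * d) * (2 ^ n ∸ 2 ^ (n ∸ k))) ×
    ((M″ : Matroid n) → (∀ x → x ≢ 𝟎 → M″ (fun ι x) ≡ M x) → Free N′ M″ →
     Any (λ M₀ → ∀ y → y ≢ 𝟎 → M″ y ≡ M₀ y) Ms)
few-free-extensions d n k d≤n k≤d ι N M (φ , φ-instance) e N′ (e≤d∸k+k , ψ , ψ-restricts) =
  Ms ,
  subst (λ l → l ^ 2 ^ (2 ^ d + 2 * d) * 2 ^ (1 * 2 ^ n) ≤ _) (sym length-Ms)
        (matroid-count-bound {d} {n} {k} {s} |outsideψ|≤2^d n≤s+2d points-count) ,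
  λ M″ agree free → cover M″ agree λ w block≡ →
    free (embedding w) (block≡forbidden⇒instance M″ agree N φ-instance ψ-restricts w block≡)
  where
  Eι : Extension (fun ι)
  Eι = extension ι

  Eφ : Extension (fun φ)
  Eφ = extension φ

  Eψ : Extension (fun ψ)
  Eψ = extension ψ

  k≤n : k ≤ n
  k≤n = ≤-trans k≤d d≤n

  d∸k+k≡d : d ∸ k + k ≡ d
  d∸k+k≡d = m∸n+n≡m k≤d

  j≤k : codim Eψ ≤ k
  j≤k = +-cancelˡ-≤ (d ∸ k) (codim Eψ) k (subst (_≤ d ∸ k + k) (sym (dim Eψ)) e≤d∸k+k)

  codimι≡k : codim Eι ≡ k
  codimι≡k = +-cancelˡ-≡ (n ∸ k) (codim Eι) k (trans (dim Eι) (sym (m∸n+n≡m k≤n)))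

  open Embeddings Eι Eφ Eψ (subst (codim Eψ ≤_) (sym codimι≡k) j≤k)
  open Candidates M N′

  |outsideψ|≤2^d : length outsideψ ≤ 2 ^ d
  |outsideψ|≤2^d = ≤-trans (length-filter _ (vectors e)) (subst (_≤ 2 ^ d) (sym (length-vectors e))
                     (^-monoʳ-≤ 2 (≤-trans e≤d∸k+k (≤-reflexive d∸k+k≡d))))

  n≤s+2d : n ≤ s + 2 * d
  n≤s+2d = subst (λ x → n ≤ s + 2 * x) d∸k+k≡d
                 (dimension-bound (trans (cong (_+ k) (dim Eφ)) (m∸n+n≡m k≤n)) j≤k)

lemma3p2 : (d : ℕ) → 1 ≤ d →
    Σ ℕ λ p → Σ ℕ λ q → 1 ≤ p × 1 ≤ q ×
      ((n k : ℕ) → d ≤ n → k ≤ d → 1 ≤ k →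
       (ι : LinInj (n ∸ k) n) →
       (N : Pattern (d ∸ k)) →
       (M : Matroid (n ∸ k)) →
       Σ (LinInj (d ∸ k) (n ∸ k)) (IsInstance N M) →
       (e : ℕ) (N' : Pattern e) → InExt k N N' →
       Σ (List (Matroid n)) λ Ms →
         (length Ms ^ q) * (2 ^ (p * 2 ^ n)) ≤ 2 ^ (q * (2 ^ n ∸ 2 ^ (n ∸ k))) ×
         ((M'' : Matroid n) →
          (∀ x → x ≢ 𝟎 → M'' (fun ι x) ≡ M x) →
          Free N' M'' →
          Any (λ M₀ → ∀ y → y ≢ 𝟎 → M'' y ≡ M₀ y) Ms))
lemma3p2 d _ = 1 , 2 ^ (2 ^ d + 2 * d) , s≤s z≤n , m^n>0 2 (2 ^ d + 2 * d) ,
  λ n k d≤n k≤d _ → few-free-extensions d n k d≤n k≤d
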